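{- Every pair $(G,S)\in\mathcal{B}$ admits a valid orientation; that is, there exist an orientation $D$ of $G$ and an orientation $\vec{S}$ of the edges of $S$ such that for every vertex $v$ of $G$, $$d^{+}_{D}(v)\le \min\{3- d_{\vec{S}}^+(v),\ d_{G}(v)-1 +d_{\vec{S}}^-(v) \}.$$
   Context: $\mathcal{B}$ is the set of pairs $(G,S)$ such that either (1) $G$ is a 2-connected bipartite outerplanar graph (with a fixed outerplanar embedding) and $S$ is a (possibly empty) set of boundary edges of $G$ (edges on the outer face); or (2) $G=K_2$ and $S$ consists of one or two parallel edges connecting the two vertices of $G$. An orientation $\vec{S}$ of $S$ assigns a direction to each edge of $S$ (parallel copies are oriented independently); $d^+_{\vec{S}}(v)$ and $d^-_{\vec{S}}(v)$ denote the number of arcs of $\vec S$ leaving, resp. entering, $v$. -}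

module Defs where

open import Data.Nat using (ℕ; zero; suc; _+_; _≤_; _<_)
open import Data.Fin using (Fin; zero; suc; toℕ; _≟_)
open import Data.Bool using (Bool; true; false; not; if_then_else_)
open import Data.List using (List; length; lookup)
open import Data.List.Relation.Unary.All using (All)
open import Data.List.Relation.Unary.Unique.Propositional using (Unique)
open import Data.Product using (Σ; _×_; _,_; proj₁; proj₂)
open import Data.Sum using (_⊎_)
open import Relation.Nullary using (¬_)
open import Relation.Nullary.Decidable using (⌊_⌋)
open import Relation.Binary.PropositionalEquality using (_≡_; _≢_)

count : ∀ {n} → (Fin n → Bool) → ℕ
count {zero}  f = 0
count {suc n} f = (if f zero then 1 else 0) + count (λ i → f (suc i))

record Graph (n : ℕ) : Set where
  field
    adj      : Fin n → Fin n → Bool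
    irrefl   : ∀ u → adj u u ≡ false
    symmetric : ∀ u v → adj u v ≡ adj v u
open Graph public

deg : ∀ {n} → Graph n → Fin n → ℕ
deg G v = count (adj G v)

record Orientation {n : ℕ} (G : Graph n) : Set where
  field
    arc       : Fin n → Fin n → Bool
    arc⇒edge  : ∀ u v → arc u v ≡ true → adj G u v ≡ true
    edge⇒one  : ∀ u v → adj G u v ≡ true → arc u v ≡ not (arc v u)
open Orientation public

outdeg : ∀ {n} {G : Graph n} → Orientation G → Fin n → ℕ
outdeg D v = count (arc D v)

Bipartite : ∀ {n} → Graph n → Set
Bipartite {n} G = Σ (Fin n → Bool) λ col → ∀ u v → adj G u v ≡ true → col u ≢ col v

-- Convention: the vertices are labelled 0,1,...,n-1 in the cyclic order in which
-- they appear on the outer face.  (u , v) is a boundary (outer-cycle) edge,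
-- written in the direction of increasing cyclic label: v = u + 1 mod n.
IsCycleStep : (n : ℕ) → Fin n → Fin n → Set
IsCycleStep n u v = (suc (toℕ u) ≡ toℕ v) ⊎ ((suc (toℕ u) ≡ n) × (toℕ v ≡ 0))

-- A 2-connected outerplanar graph with a fixed outerplanar embedding:
-- n ≥ 3 vertices, the outer face is the Hamiltonian cycle 0,1,...,n-1,0
-- and all other edges (chords) are pairwise non-crossing.
record TwoConnOuterplane (n : ℕ) : Set where
  field
    graph       : Graph n
    three≤n     : 3 ≤ n
    cycleEdges  : ∀ u v → IsCycleStep n u v → adj graph u v ≡ true
    nonCrossing : ∀ a b c d → toℕ a < toℕ b → toℕ b < toℕ c → toℕ c < toℕ d →
                  adj graph a c ≡ true → adj graph b d ≡ false
open TwoConnOuterplane public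

-- A multiset S of edges given as a list of vertex pairs; an orientation of S
-- chooses, independently for each listed edge (u , v), either u→v (true) or v→u (false).
SOrientation : ∀ {n} → List (Fin n × Fin n) → Set
SOrientation S = Fin (length S) → Bool

tail′ head′ : ∀ {n} (S : List (Fin n × Fin n)) → SOrientation S → Fin (length S) → Fin n
tail′ S σ i = if σ i then proj₁ (lookup S i) else proj₂ (lookup S i)
head′ S σ i = if σ i then proj₂ (lookup S i) else proj₁ (lookup S i)

outdegS : ∀ {n} (S : List (Fin n × Fin n)) → SOrientation S → Fin n → ℕ
outdegS S σ v = count (λ i → ⌊ tail′ S σ i ≟ v ⌋)

indegS : ∀ {n} (S : List (Fin n × Fin n)) → SOrientation S → Fin n → ℕ
indegS S σ v = count (λ i → ⌊ head′ S σ i ≟ v ⌋)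

-- Valid orientation: D of G and S→ of S with, for every vertex v,
--   d^+_D(v) ≤ min{ 3 - d^+_S(v) , d_G(v) - 1 + d^-_S(v) }
-- written over ℕ without subtraction (the two inequalities are equivalent over ℤ).
ValidOrientation : ∀ {n} (G : Graph n) → List (Fin n × Fin n) → Set
ValidOrientation G S =
  Σ (Orientation G) λ D → Σ (SOrientation S) λ σ → ∀ v →
    (outdeg D v + outdegS S σ v ≤ 3) × (outdeg D v + 1 ≤ deg G v + indegS S σ v)

InB₁ : ∀ {n} → TwoConnOuterplane n → List (Fin n × Fin n) → Set
InB₁ {n} O S = Bipartite (graph O) × All (λ e → IsCycleStep n (proj₁ e) (proj₂ e)) S × Unique S

K₂ : Graph 2
K₂ = record { adj = λ u v → not ⌊ u ≟ v ⌋ ; irrefl = irr ; symmetric = sym′ }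
  where
  irr : ∀ u → not ⌊ u ≟ u ⌋ ≡ false
  irr zero = _≡_.refl
  irr (suc zero) = _≡_.refl
  sym′ : ∀ u v → not ⌊ u ≟ v ⌋ ≡ not ⌊ v ≟ u ⌋
  sym′ zero zero = _≡_.refl
  sym′ zero (suc zero) = _≡_.refl
  sym′ (suc zero) zero = _≡_.refl
  sym′ (suc zero) (suc zero) = _≡_.refl

InB₂ : List (Fin 2 × Fin 2) → Set
InB₂ S = (1 ≤ length S) × (length S ≤ 2) × All (λ e → e ≡ (zero , suc zero)) S

{-# OPTIONS --safe #-}
-- Orient the outer cycle cyclically, and orient the chords and the copies in S by one orientation X
-- of G of out-degree at most 2.  Every vertex then receives the cycle arc from its predecessor, and
-- its out-degree in D plus its out-degree in S is at most 1 + 2, since the chords and the S-edges at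
-- a vertex are distinct edges of G.  Such an X exists for every non-crossing graph on 0, …, n-1:
-- orient an edge u < w upwards exactly when w is the largest neighbour of u.  A vertex v then has at
-- most one upward out-arc, and at most one downward one: downward arcs v → u and v → u' with
-- u < u' < v give u' a neighbour x > v, and the edges uv and u'x cross.
module Submission where

open import Defs
open import Data.Bool using (Bool; true; false; not; _∧_; _∨_; if_then_else_)
open import Data.Bool.Properties using (not-involutive; not-¬; ∧-identityʳ; ∧-zeroʳ; ∨-zeroʳ)
  renaming (_≟_ to _≟ᵇ_)
open import Data.Empty using (⊥; ⊥-elim)
open import Data.Fin using (Fin; zero; suc; toℕ; fromℕ; inject₁; _≟_)
open import Data.Fin.Properties using (toℕ-injective; toℕ<n; toℕ-fromℕ; toℕ-inject₁; any?)
  renaming (suc-injective to fsuc-injective)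
open import Data.List using (List; []; _∷_; lookup)
open import Data.List.Membership.Propositional.Properties using (∈-lookup)
open import Data.List.Relation.Unary.All as All using (All; []; _∷_)
open import Data.List.Relation.Unary.AllPairs using (_∷_)
open import Data.List.Relation.Unary.Unique.Propositional using (Unique)
open import Data.Nat as ℕ using (ℕ; zero; suc; _+_; _≤_; _<_; z≤n; s≤s; _<?_)
open import Data.Nat.Properties hiding (_≟_)
open import Data.Product using (∃; _×_; _,_; proj₁; proj₂)
open import Data.Sum using (_⊎_; inj₁; inj₂)
open import Data.Unit using (tt)
open import Relation.Binary.Definitions using (tri<; tri≈; tri>)
open import Relation.Binary.PropositionalEquality
open import Relation.Nullary using (¬_; Dec; yes; no; contradiction)
open import Relation.Nullary.Decidable using (⌊_⌋; _×-dec_; _⊎-dec_)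

∧-true : ∀ {a b} → a ∧ b ≡ true → a ≡ true × b ≡ true
∧-true {true}  {true}  _  = refl , refl
∧-true {true}  {false} ()
∧-true {false}         ()

witness : ∀ {A : Set} {a? : Dec A} → ⌊ a? ⌋ ≡ true → A
witness {a? = yes a} _ = a
witness {a? = no _}  ()

refute : ∀ {A : Set} {a? : Dec A} → not ⌊ a? ⌋ ≡ true → ¬ A
refute {a? = no ¬a} _ = ¬a
refute {a? = yes _} ()

indicator-mono : ∀ {a b : Bool} → (a ≡ true → b ≡ true) → (if a then 1 else 0) ≤ (if b then 1 else 0)
indicator-mono {false} _   = z≤n
indicator-mono {true}  a⇒b rewrite a⇒b refl = ≤-refl

count-mono : ∀ {n} {f g : Fin n → Bool} → (∀ i → f i ≡ true → g i ≡ true) → count f ≤ count g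
count-mono {zero}  _   = z≤n
count-mono {suc n} f⊆g = +-mono-≤ (indicator-mono (f⊆g zero)) (count-mono (λ i → f⊆g (suc i)))

count-strict : ∀ {n} {f g : Fin n → Bool} {j} → (∀ i → f i ≡ true → g i ≡ true) →
               g j ≡ true → f j ≡ false → suc (count f) ≤ count g
count-strict {suc n} {j = zero} f⊆g gj fj rewrite gj | fj = s≤s (count-mono (λ i → f⊆g (suc i)))
count-strict {suc n} {j = suc j} f⊆g gj fj =
  ≤-trans (≤-reflexive (sym (+-suc _ _)))
          (+-mono-≤ (indicator-mono (f⊆g zero)) (count-strict {j = j} (λ i → f⊆g (suc i)) gj fj))

count-partition : ∀ {n} (f p : Fin n → Bool) →
                  count f ≡ count (λ i → f i ∧ p i) + count (λ i → f i ∧ not (p i))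
count-partition {zero}  f p = refl
count-partition {suc n} f p with f zero | p zero | count-partition (λ i → f (suc i)) (λ i → p (suc i))
... | false | _     | ih = ih
... | true  | true  | ih = cong suc ih
... | true  | false | ih = trans (cong suc ih) (sym (+-suc _ _))

count-injection : ∀ {m n} {f : Fin m → Bool} {g : Fin n → Bool} (h : Fin m → Fin n) →
                  (∀ i → f i ≡ true → g (h i) ≡ true) →
                  (∀ i j → f i ≡ true → f j ≡ true → h i ≡ h j → i ≡ j) →
                  count f ≤ count g
count-injection {zero} _ _ _ = z≤n
count-injection {suc m} {f = f} {g} h into inj with f zero in f0
... | false = count-injection (λ i → h (suc i)) (λ i → into (suc i))
                (λ i j fi fj e → fsuc-injective (inj (suc i) (suc j) fi fj e))
... | true  = ≤-trans (s≤s (count-injection {g = g-rest} (λ i → h (suc i)) into-rest inj-rest))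
                      (count-strict {f = g-rest} (λ k e → proj₁ (∧-true e)) (into zero f0) h0-removed)
  where
  g-rest : Fin _ → Bool
  g-rest k = g k ∧ not ⌊ k ≟ h zero ⌋
  into-rest : ∀ i → f (suc i) ≡ true → g-rest (h (suc i)) ≡ true
  into-rest i fi with h (suc i) ≟ h zero
  ... | yes e = contradiction (inj (suc i) zero fi f0 e) λ ()
  ... | no _  = trans (∧-identityʳ _) (into (suc i) fi)
  inj-rest : ∀ i j → f (suc i) ≡ true → f (suc j) ≡ true → h (suc i) ≡ h (suc j) → i ≡ j
  inj-rest i j fi fj e = fsuc-injective (inj (suc i) (suc j) fi fj e)
  h0-removed : g-rest (h zero) ≡ false
  h0-removed with h zero ≟ h zero
  ... | yes _ = ∧-zeroʳ _
  ... | no ¬r = contradiction refl ¬r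

count-atMostOne : ∀ {n} {f : Fin n → Bool} → (∀ i j → f i ≡ true → f j ≡ true → i ≡ j) → count f ≤ 1
count-atMostOne unique =
  count-injection {g = λ (_ : Fin 1) → true} (λ _ → zero) (λ _ _ → refl) (λ i j fi fj _ → unique i j fi fj)

lookup-injective : ∀ {A : Set} {xs : List A} → Unique xs → ∀ i j → lookup xs i ≡ lookup xs j → i ≡ j
lookup-injective (_    ∷ _) zero    zero    _ = refl
lookup-injective (x∉xs ∷ _) zero    (suc j) e = contradiction e (All.lookup x∉xs (∈-lookup j))
lookup-injective (x∉xs ∷ _) (suc i) zero    e = contradiction (sym e) (All.lookup x∉xs (∈-lookup i))
lookup-injective (_    ∷ u) (suc i) (suc j) e = cong suc (lookup-injective u i j e)

adj⇒≢ : ∀ {n} (G : Graph n) {u w} → adj G u w ≡ true → u ≢ w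
adj⇒≢ G {u} e refl = contradiction (trans (sym e) (irrefl G u)) λ ()

NonCrossing : ∀ {n} → Graph n → Set
NonCrossing {n} G = ∀ (a b c d : Fin n) → toℕ a < toℕ b → toℕ b < toℕ c → toℕ c < toℕ d →
                    adj G a c ≡ true → adj G b d ≡ false

module Extremal {n} (G : Graph n) where

  HasNeighbourAbove : Fin n → Fin n → Set
  HasNeighbourAbove u w = ∃ λ x → adj G u x ≡ true × toℕ w < toℕ x

  hasNeighbourAbove? : ∀ u w → Dec (HasNeighbourAbove u w)
  hasNeighbourAbove? u w = any? λ x → (adj G u x ≟ᵇ true) ×-dec (toℕ w <? toℕ x)

  toward : Fin n → Fin n → Bool
  toward u w with <-cmp (toℕ u) (toℕ w)
  ... | tri< _ _ _ = not ⌊ hasNeighbourAbove? u w ⌋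
  ... | tri≈ _ _ _ = false
  ... | tri> _ _ _ = ⌊ hasNeighbourAbove? w u ⌋

  toward-up : ∀ {u w} → toℕ u < toℕ w → toward u w ≡ not ⌊ hasNeighbourAbove? u w ⌋
  toward-up {u} {w} u<w with <-cmp (toℕ u) (toℕ w)
  ... | tri< _   _ _ = refl
  ... | tri≈ u≮w _ _ = contradiction u<w u≮w
  ... | tri> u≮w _ _ = contradiction u<w u≮w

  toward-down : ∀ {u w} → toℕ w < toℕ u → toward u w ≡ ⌊ hasNeighbourAbove? w u ⌋
  toward-down {u} {w} w<u with <-cmp (toℕ u) (toℕ w)
  ... | tri< _ _ w≮u = contradiction w<u w≮u
  ... | tri≈ _ _ w≮u = contradiction w<u w≮u
  ... | tri> _ _ _   = refl

  toward-antisym : ∀ {u w} → u ≢ w → toward u w ≡ not (toward w u)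
  toward-antisym {u} {w} u≢w with <-cmp (toℕ u) (toℕ w)
  ... | tri< u<w _ _ = cong not (sym (toward-down u<w))
  ... | tri≈ _ u≡w _ = contradiction (toℕ-injective u≡w) u≢w
  ... | tri> _ _ w<u = sym (trans (cong not (toward-up w<u)) (not-involutive _))

  extremal : Orientation G
  extremal = record
    { arc      = λ u w → adj G u w ∧ toward u w
    ; arc⇒edge = λ u w e → proj₁ (∧-true e)
    ; edge⇒one = one
    }
    where
    one : ∀ u w → adj G u w ≡ true → adj G u w ∧ toward u w ≡ not (adj G w u ∧ toward w u)
    one u w e rewrite e | trans (symmetric G w u) e = toward-antisym (adj⇒≢ G e)

  upward-arc⇒no-neighbour-above : ∀ {v w} → toℕ v < toℕ w → arc extremal v w ≡ true → ¬ HasNeighbourAbove v w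
  upward-arc⇒no-neighbour-above v<w a = refute (trans (sym (toward-up v<w)) (proj₂ (∧-true a)))

  downward-arc⇒neighbour-above : ∀ {v w} → toℕ w < toℕ v → arc extremal v w ≡ true → HasNeighbourAbove w v
  downward-arc⇒neighbour-above w<v a = witness (trans (sym (toward-down w<v)) (proj₂ (∧-true a)))

  upward-unique : ∀ {v w w'} → toℕ v < toℕ w → toℕ v < toℕ w' →
                  arc extremal v w ≡ true → arc extremal v w' ≡ true → w ≡ w'
  upward-unique {v} {w} {w'} v<w v<w' a a' with <-cmp (toℕ w) (toℕ w')
  ... | tri< w<w' _ _ = contradiction (w' , arc⇒edge extremal v w' a' , w<w') (upward-arc⇒no-neighbour-above v<w a)
  ... | tri≈ _ w≡w' _ = toℕ-injective w≡w'
  ... | tri> _ _ w'<w = contradiction (w , arc⇒edge extremal v w a , w'<w) (upward-arc⇒no-neighbour-above v<w' a')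

  no-two-downward-arcs : NonCrossing G → ∀ {v u u'} → toℕ u < toℕ u' → toℕ u' < toℕ v →
                         arc extremal v u ≡ true → arc extremal v u' ≡ true → ⊥
  no-two-downward-arcs noncrossing {v} {u} {u'} u<u' u'<v a a'
    with downward-arc⇒neighbour-above u'<v a'
  ... | x , u'x , v<x = contradiction u'x (not-¬ (noncrossing u u' v x u<u' u'<v v<x uv))
    where
    uv : adj G u v ≡ true
    uv = trans (symmetric G u v) (arc⇒edge extremal v u a)

  downward-unique : NonCrossing G → ∀ {v w w'} → toℕ w < toℕ v → toℕ w' < toℕ v →
                    arc extremal v w ≡ true → arc extremal v w' ≡ true → w ≡ w'
  downward-unique noncrossing {v} {w} {w'} w<v w'<v a a' with <-cmp (toℕ w) (toℕ w')
  ... | tri< w<w' _ _ = ⊥-elim (no-two-downward-arcs noncrossing w<w' w'<v a a')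
  ... | tri≈ _ w≡w' _ = toℕ-injective w≡w'
  ... | tri> _ _ w'<w = ⊥-elim (no-two-downward-arcs noncrossing w'<w w<v a' a)

  extremal-outdeg≤2 : NonCrossing G → ∀ v → outdeg extremal v ≤ 2
  extremal-outdeg≤2 noncrossing v =
    ≤-trans (≤-reflexive (count-partition (arc extremal v) above))
            (+-mono-≤ (count-atMostOne upward) (count-atMostOne downward))
    where
    above : Fin n → Bool
    above w = ⌊ toℕ v <? toℕ w ⌋
    upward : ∀ w w' → arc extremal v w ∧ above w ≡ true → arc extremal v w' ∧ above w' ≡ true → w ≡ w'
    upward w w' e e' with ∧-true e | ∧-true e'
    ... | a , v<w | a' , v<w' = upward-unique (witness v<w) (witness v<w') a a'
    below : ∀ {w} → arc extremal v w ≡ true → not (above w) ≡ true → toℕ w < toℕ v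
    below {w} a v≮w = ≤∧≢⇒< (≮⇒≥ (refute v≮w)) λ w≡v → adj⇒≢ G (arc⇒edge extremal v w a) (toℕ-injective (sym w≡v))
    downward : ∀ w w' → arc extremal v w ∧ not (above w) ≡ true → arc extremal v w' ∧ not (above w') ≡ true → w ≡ w'
    downward w w' e e' with ∧-true e | ∧-true e'
    ... | a , v≮w | a' , v≮w' = downward-unique noncrossing (below a v≮w) (below a' v≮w') a a'

cycleStep? : ∀ {n} (u w : Fin n) → Dec (IsCycleStep n u w)
cycleStep? {n} u w = (suc (toℕ u) ℕ.≟ toℕ w) ⊎-dec ((suc (toℕ u) ℕ.≟ n) ×-dec (toℕ w ℕ.≟ 0))

cycleStep-functional : ∀ {n} {u w w' : Fin n} → IsCycleStep n u w → IsCycleStep n u w' → w ≡ w'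
cycleStep-functional           (inj₁ p)       (inj₁ p')       = toℕ-injective (trans (sym p) p')
cycleStep-functional {w = w}   (inj₁ p)       (inj₂ (q' , _)) = contradiction (toℕ<n w) (<-irrefl (trans (sym p) q'))
cycleStep-functional {w' = w'} (inj₂ (q , _)) (inj₁ p')       = contradiction (toℕ<n w') (<-irrefl (trans (sym p') q))
cycleStep-functional           (inj₂ (_ , r)) (inj₂ (_ , r')) = toℕ-injective (trans r (sym r'))

cycleStep-asym : ∀ {n} {u w : Fin n} → 3 ≤ n → IsCycleStep n u w → ¬ IsCycleStep n w u
cycleStep-asym 3≤n s s' = asym s s' 3≤n
  where
  asym : ∀ {a b m} → (suc a ≡ b ⊎ (suc a ≡ m × b ≡ 0)) → (suc b ≡ a ⊎ (suc b ≡ m × a ≡ 0)) → ¬ 3 ≤ m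
  asym (inj₁ refl)          (inj₁ ())
  asym (inj₁ refl)          (inj₂ (refl , refl)) (s≤s (s≤s ()))
  asym (inj₂ (refl , refl)) (inj₁ refl)          (s≤s (s≤s ()))
  asym (inj₂ (refl , refl)) (inj₂ (refl , refl)) (s≤s ())

predecessor : ∀ {n} (v : Fin n) → ∃ λ u → IsCycleStep n u v
predecessor {suc m} zero    = fromℕ m , inj₂ (cong suc (toℕ-fromℕ m) , refl)
predecessor         (suc v) = inject₁ v , inj₁ (cong suc (toℕ-inject₁ v))

oriented-step-injective : ∀ {n} → 3 ≤ n → ∀ {x y x' y' : Fin n} (b b' : Bool) →
                          IsCycleStep n x y → IsCycleStep n x' y' →
                          (if b then x else y) ≡ (if b' then x' else y') →
                          (if b then y else x) ≡ (if b' then y' else x') → (x , y) ≡ (x' , y')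
oriented-step-injective _   true  true  _ _  refl refl = refl
oriented-step-injective _   false false _ _  refl refl = refl
oriented-step-injective 3≤n true  false s s' refl refl = contradiction s' (cycleStep-asym 3≤n s)
oriented-step-injective 3≤n false true  s s' refl refl = contradiction s' (cycleStep-asym 3≤n s)

module OuterCycle {n} (O : TwoConnOuterplane n) (X : Orientation (graph O)) where

  step : Fin n → Fin n → Bool
  step u w = ⌊ cycleStep? u w ⌋

  onCycle : Fin n → Fin n → Bool
  onCycle u w = step u w ∨ step w u

  step-true : ∀ {u w} → IsCycleStep n u w → step u w ≡ true
  step-true {u} {w} s with cycleStep? u w
  ... | yes _ = refl
  ... | no ¬s = contradiction s ¬s

  cyclicArc : Fin n → Fin n → Bool
  cyclicArc u w = if step u w then true else if step w u then false else arc X u w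

  cyclic : Orientation (graph O)
  cyclic = record { arc = cyclicArc ; arc⇒edge = cyclic-arc⇒edge ; edge⇒one = cyclic-edge⇒one }
    where
    cyclic-arc⇒edge : ∀ u w → cyclicArc u w ≡ true → adj (graph O) u w ≡ true
    cyclic-arc⇒edge u w e with cycleStep? u w | cycleStep? w u
    ... | yes s | _     = cycleEdges O u w s
    ... | no _  | no _  = arc⇒edge X u w e
    cyclic-arc⇒edge u w () | no _ | yes _
    cyclic-edge⇒one : ∀ u w → adj (graph O) u w ≡ true → cyclicArc u w ≡ not (cyclicArc w u)
    cyclic-edge⇒one u w e with cycleStep? u w | cycleStep? w u
    ... | yes s | yes s' = contradiction s' (cycleStep-asym (three≤n O) s)
    ... | yes _ | no _   = refl
    ... | no _  | yes _  = refl
    ... | no _  | no _   = edge⇒one X u w e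

  cyclic-outdeg : ∀ v → outdeg cyclic v ≤ 1 + count (λ w → arc X v w ∧ not (onCycle v w))
  cyclic-outdeg v =
    ≤-trans (≤-reflexive (count-partition (cyclicArc v) (onCycle v)))
            (+-mono-≤ (≤-trans (count-mono cycle-arc) (count-atMostOne successor-unique)) (count-mono chord-arc))
    where
    cycle-arc : ∀ w → cyclicArc v w ∧ onCycle v w ≡ true → step v w ≡ true
    cycle-arc w e with cycleStep? v w | cycleStep? w v
    ... | yes _ | _    = refl
    ... | no _  | no _ = proj₂ (∧-true e)
    cycle-arc w () | no _ | yes _
    chord-arc : ∀ w → cyclicArc v w ∧ not (onCycle v w) ≡ true → arc X v w ∧ not (onCycle v w) ≡ true
    chord-arc w e with cycleStep? v w | cycleStep? w v
    ... | no _  | no _ = e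
    chord-arc w () | yes _ | _
    chord-arc w () | no _  | yes _
    successor-unique : ∀ w w' → step v w ≡ true → step v w' ≡ true → w ≡ w'
    successor-unique w w' s s' = cycleStep-functional (witness s) (witness s')

  cyclic-indeg≥1 : ∀ v → outdeg cyclic v + 1 ≤ deg (graph O) v
  cyclic-indeg≥1 v with predecessor v
  ... | u , u→v = ≤-trans (≤-reflexive (+-comm _ 1)) (count-strict (arc⇒edge cyclic v) v~u v↛u)
    where
    v~u : adj (graph O) v u ≡ true
    v~u = trans (symmetric (graph O) v u) (cycleEdges O u v u→v)
    v↛u : cyclicArc v u ≡ false
    v↛u with cycleStep? v u | cycleStep? u v
    ... | yes v→u | _     = contradiction v→u (cycleStep-asym (three≤n O) u→v)
    ... | no _    | yes _ = refl
    ... | no _    | no ¬s = contradiction u→v ¬s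

  along : (S : List (Fin n × Fin n)) → SOrientation S
  along S i = arc X (proj₁ (lookup S i)) (proj₂ (lookup S i))

  oriented-step-arc : ∀ {x y} → IsCycleStep n x y →
                      let b = arc X x y in
                      arc X (if b then x else y) (if b then y else x) ∧ onCycle (if b then x else y) (if b then y else x) ≡ true
  oriented-step-arc {x} {y} s with arc X x y in e
  ... | true  rewrite e | step-true s = refl
  ... | false rewrite edge⇒one X y x (trans (symmetric (graph O) y x) (cycleEdges O x y s)) | e | step-true s
                    | ∨-zeroʳ (step y x) = refl

  outdegS-along : ∀ {S} → All (λ e → IsCycleStep n (proj₁ e) (proj₂ e)) S → Unique S →
                  ∀ v → outdegS S (along S) v ≤ count (λ w → arc X v w ∧ onCycle v w)
  outdegS-along {S} steps unique v = count-injection (head′ S σ) tail-v-out heads-distinct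
    where
    σ : SOrientation S
    σ = along S
    step-at : ∀ i → IsCycleStep n (proj₁ (lookup S i)) (proj₂ (lookup S i))
    step-at i = All.lookup steps (∈-lookup i)
    tail-v-out : ∀ i → ⌊ tail′ S σ i ≟ v ⌋ ≡ true → arc X v (head′ S σ i) ∧ onCycle v (head′ S σ i) ≡ true
    tail-v-out i t≡v = subst (λ t → arc X t (head′ S σ i) ∧ onCycle t (head′ S σ i) ≡ true) (witness t≡v)
                             (oriented-step-arc (step-at i))
    heads-distinct : ∀ i j → ⌊ tail′ S σ i ≟ v ⌋ ≡ true → ⌊ tail′ S σ j ≟ v ⌋ ≡ true →
                     head′ S σ i ≡ head′ S σ j → i ≡ j
    heads-distinct i j ti tj hij = lookup-injective unique i j
      (oriented-step-injective (three≤n O) (σ i) (σ j) (step-at i) (step-at j) (trans (witness ti) (sym (witness tj))) hij)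

outerplane-valid : (n : ℕ) (O : TwoConnOuterplane n) (S : List (Fin n × Fin n)) →
                   InB₁ O S → ValidOrientation (graph O) S
outerplane-valid n O S (_ , steps , unique) = cyclic , along S , λ v → out-bound v , in-bound v
  where
  open Extremal (graph O) using (extremal; extremal-outdeg≤2)
  open OuterCycle O extremal
  open ≤-Reasoning
  out-bound : ∀ v → outdeg cyclic v + outdegS S (along S) v ≤ 3
  out-bound v = begin
    outdeg cyclic v + outdegS S (along S) v ≤⟨ +-mono-≤ (cyclic-outdeg v) (outdegS-along steps unique v) ⟩
    1 + chords + cycleArcs                  ≡⟨ cong suc (+-comm chords cycleArcs) ⟩
    1 + (cycleArcs + chords)                ≡⟨ cong suc (sym (count-partition (arc extremal v) (onCycle v))) ⟩
    1 + outdeg extremal v                   ≤⟨ s≤s (extremal-outdeg≤2 (nonCrossing O) v) ⟩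
    3                                       ∎
    where
    chords cycleArcs : ℕ
    chords    = count (λ w → arc extremal v w ∧ not (onCycle v w))
    cycleArcs = count (λ w → arc extremal v w ∧ onCycle v w)
  in-bound : ∀ v → outdeg cyclic v + 1 ≤ deg (graph O) v + indegS S (along S) v
  in-bound v = ≤-trans (cyclic-indeg≥1 v) (m≤m+n _ _)

K₂-forward : Orientation K₂
K₂-forward = record { arc = forward ; arc⇒edge = forward⇒edge ; edge⇒one = edge⇒one-forward }
  where
  forward : Fin 2 → Fin 2 → Bool
  forward zero (suc zero) = true
  forward _    _          = false
  forward⇒edge : ∀ u w → forward u w ≡ true → adj K₂ u w ≡ true
  forward⇒edge zero       (suc zero) _ = refl
  forward⇒edge zero       zero       ()
  forward⇒edge (suc zero) _          ()
  edge⇒one-forward : ∀ u w → adj K₂ u w ≡ true → forward u w ≡ not (forward w u)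
  edge⇒one-forward zero       (suc zero) _ = refl
  edge⇒one-forward (suc zero) zero       _ = refl
  edge⇒one-forward zero       zero       ()
  edge⇒one-forward (suc zero) (suc zero) ()

K₂-valid : (S : List (Fin 2 × Fin 2)) → InB₂ S → ValidOrientation K₂ S
K₂-valid []              (() , _)
K₂-valid (_ ∷ [])        (_ , _ , refl ∷ []) = K₂-forward , (λ _ → false) , λ where
  zero       → ≤ᵇ⇒≤ _ _ tt , ≤ᵇ⇒≤ _ _ tt
  (suc zero) → ≤ᵇ⇒≤ _ _ tt , ≤ᵇ⇒≤ _ _ tt
K₂-valid (_ ∷ _ ∷ [])    (_ , _ , refl ∷ refl ∷ []) = K₂-forward , (λ _ → false) , λ where
  zero       → ≤ᵇ⇒≤ _ _ tt , ≤ᵇ⇒≤ _ _ tt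
  (suc zero) → ≤ᵇ⇒≤ _ _ tt , ≤ᵇ⇒≤ _ _ tt
K₂-valid (_ ∷ _ ∷ _ ∷ _) (_ , s≤s (s≤s ()) , _)

lemma3p4 : ((n : ℕ) (O : TwoConnOuterplane n) (S : List (Fin n × Fin n)) →
               InB₁ O S → ValidOrientation (graph O) S)
             × ((S : List (Fin 2 × Fin 2)) → InB₂ S → ValidOrientation K₂ S)
lemma3p4 = outerplane-valid , K₂-valid
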